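{- Let $\Delta$ and $\Gamma$ be simplicial complexes on the same finite vertex set $V$. Then $$f_{\Delta}(q)\cdot f_{\Gamma}(q)\ \ll\ (1+q)^{|V|}\cdot f_{\Delta\cap\Gamma}(q).$$
   Context: For a simplicial complex $\Delta$ (a family of subsets of $V$ closed under taking subsets, including the empty face), its $f$-polynomial is $f_{\Delta}(q)=\sum_{i\ge 0} f_{i-1}(\Delta)q^i$, where $f_{i-1}(\Delta)$ is the number of faces of $\Delta$ of dimension $i-1$, i.e. with $i$ elements. $\Delta\cap\Gamma$ is the complex of common faces. For real polynomials, $p(q)\ll s(q)$ means $s(q)-p(q)$ has all coefficients nonnegative. -}

module Defs where

open import Data.Nat using (ℕ; zero; suc; _+_; _*_; _∸_; _≡ᵇ_)
open import Data.Nat.Combinatorics using (_C_)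
open import Data.Bool using (Bool; true; false; _∧_; if_then_else_)
open import Data.List using (List; []; _∷_; _++_; map; upTo)
open import Data.Nat.ListAction using (sum)
open import Data.Vec using ([]; _∷_)
open import Data.Fin.Subset using (Subset; _⊆_; ⊥; ∣_∣)
open import Relation.Binary.PropositionalEquality using (_≡_; refl)

record SimplicialComplex (n : ℕ) : Set where
  field
    face        : Subset n → Bool
    empty-face  : face ⊥ ≡ true
    down-closed : ∀ (σ τ : Subset n) → σ ⊆ τ → face τ ≡ true → face σ ≡ true
open SimplicialComplex public

∧-true₁ : ∀ {a b : Bool} → (a ∧ b) ≡ true → a ≡ true
∧-true₁ {true} _ = refl
∧-true₂ : ∀ {a b : Bool} → (a ∧ b) ≡ true → b ≡ true
∧-true₂ {true} p = p
∧-intro : ∀ {a b : Bool} → a ≡ true → b ≡ true → (a ∧ b) ≡ true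
∧-intro refl refl = refl

_∩ᶜ_ : ∀ {n} → SimplicialComplex n → SimplicialComplex n → SimplicialComplex n
face (Δ ∩ᶜ Γ) σ = face Δ σ ∧ face Γ σ
empty-face (Δ ∩ᶜ Γ) = ∧-intro (empty-face Δ) (empty-face Γ)
down-closed (Δ ∩ᶜ Γ) σ τ s p =
  ∧-intro (down-closed Δ σ τ s (∧-true₁ p)) (down-closed Γ σ τ s (∧-true₂ {face Δ τ} p))

allSubsets : (n : ℕ) → List (Subset n)
allSubsets zero    = [] ∷ []
allSubsets (suc n) = map (true ∷_) (allSubsets n) ++ map (false ∷_) (allSubsets n)

countᵇ : ∀ {A : Set} → (A → Bool) → List A → ℕ
countᵇ P []       = 0
countᵇ P (x ∷ xs) = (if P x then 1 else 0) + countᵇ P xs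

Poly : Set
Poly = ℕ → ℕ

_·_ : Poly → Poly → Poly
(p · s) k = sum (map (λ i → p i * s (k ∸ i)) (upTo (suc k)))

onePlusQPow : ℕ → Poly
onePlusQPow m i = m C i

-- f-polynomial: coefficient of q^i is f_{i-1}(Δ), the number of faces with i elements.
fPoly : ∀ {n} → SimplicialComplex n → Poly
fPoly {n} Δ i = countᵇ (λ σ → face Δ σ ∧ (∣ σ ∣ ≡ᵇ i)) (allSubsets n)

module Submission where

-- Work with arbitrary down-closed Boolean families F ⊆ 2^V and
-- induct on |V| = n.  Splitting off the first vertex v writes
--     f_F = q·f_{lk F} + f_{del F},
-- where del F = {σ : σ ∈ F, v ∉ σ} and lk F = {σ : σ ∪ {v} ∈ F} are again
-- down-closed on n vertices, and lk F ⊆ del F.  With (1+q)^{n+1} = q·P + P,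
-- P = (1+q)^n, both sides of the inequality expand as  q(q·X + Y) + Z :
--     f_F f_G      : X = f_lkF f_lkG,   Y = f_lkF f_delG + f_delF f_lkG,   Z = f_delF f_delG,
--     (1+q)^{n+1} f_{F∩G} : X = P f_{lkF∩lkG}, Y = P(f_{delF∩delG} + f_{lkF∩lkG}), Z = P f_{delF∩delG}.
-- X and Z are compared by induction; for Y, induction bounds the cross terms
-- by P(f_{lkF∩delG} + f_{delF∩lkG}), and lk ⊆ del gives the face-wise
-- "crossing" inequality f_{lkF∩delG} + f_{delF∩lkG} ≪ f_{delF∩delG} + f_{lkF∩lkG}.

open import Defs
open import Data.Nat using (ℕ; zero; suc; _+_; _*_; _∸_; _≡ᵇ_; _≤_; _<_; z≤n; s≤s)
open import Data.Nat.Properties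
open import Data.Nat.Combinatorics using (_C_; nCk+nC[k+1]≡[n+1]C[k+1])
open import Data.Bool using (Bool; true; false; _∧_; if_then_else_)
open import Data.Bool.Properties using (∧-zeroʳ)
open import Data.List using (List; []; _∷_; _++_; map; applyUpTo)
open import Data.Nat.ListAction using (sum)
open import Data.Vec using ([]; _∷_)
open import Data.Fin.Subset using (Subset; _⊆_; ∣_∣)
open import Data.Fin.Subset.Properties using (s⊆s; out⊆)
open import Relation.Binary.PropositionalEquality
open import Data.Nat.Tactic.RingSolver using (solve-∀)

Σ< : ℕ → (ℕ → ℕ) → ℕ
Σ< zero    f = 0
Σ< (suc n) f = f 0 + Σ< n (λ i → f (suc i))

sum-applyUpTo : ∀ (f g : ℕ → ℕ) n → sum (map f (applyUpTo g n)) ≡ Σ< n (λ i → f (g i))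
sum-applyUpTo f g zero    = refl
sum-applyUpTo f g (suc n) = cong (f (g 0) +_) (sum-applyUpTo f (λ i → g (suc i)) n)

Σ<-cong : ∀ n {f g : ℕ → ℕ} → (∀ i → i < n → f i ≡ g i) → Σ< n f ≡ Σ< n g
Σ<-cong zero    eq = refl
Σ<-cong (suc n) eq = cong₂ _+_ (eq 0 (s≤s z≤n)) (Σ<-cong n (λ i i<n → eq (suc i) (s≤s i<n)))

Σ<-mono : ∀ n {f g : ℕ → ℕ} → (∀ i → f i ≤ g i) → Σ< n f ≤ Σ< n g
Σ<-mono zero    le = z≤n
Σ<-mono (suc n) le = +-mono-≤ (le 0) (Σ<-mono n (λ i → le (suc i)))

Σ<-+ : ∀ n (f g : ℕ → ℕ) → Σ< n (λ i → f i + g i) ≡ Σ< n f + Σ< n g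
Σ<-+ zero    f g = refl
Σ<-+ (suc n) f g = trans (cong (f 0 + g 0 +_) (Σ<-+ n _ _)) (interchange (f 0) (g 0) _ _)
  where
  interchange : ∀ a b c d → (a + b) + (c + d) ≡ (a + c) + (b + d)
  interchange = solve-∀

Σ<-zero : ∀ n (f : ℕ → ℕ) → (∀ i → f i ≡ 0) → Σ< n f ≡ 0
Σ<-zero zero    f z = refl
Σ<-zero (suc n) f z = cong₂ _+_ (z 0) (Σ<-zero n _ (λ i → z (suc i)))

Σ<-snoc : ∀ n (f : ℕ → ℕ) → Σ< (suc n) f ≡ Σ< n f + f n
Σ<-snoc zero    f = +-comm (f 0) 0
Σ<-snoc (suc n) f = trans (cong (f 0 +_) (Σ<-snoc n _)) (sym (+-assoc (f 0) _ _))

_≈_ : Poly → Poly → Set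
p ≈ s = ∀ k → p k ≡ s k

_≪_ : Poly → Poly → Set
p ≪ s = ∀ k → p k ≤ s k

_⊕_ : Poly → Poly → Poly
(p ⊕ s) k = p k + s k

-- Multiplication by q.
shift : Poly → Poly
shift p zero    = 0
shift p (suc k) = p k

𝟘 𝟙 : Poly
𝟘 _       = 0
𝟙 zero    = 1
𝟙 (suc _) = 0

_⋆_ : Poly → Poly → Poly
(p ⋆ s) k = Σ< (suc k) (λ i → p i * s (k ∸ i))

·≈⋆ : ∀ p s → (p · s) ≈ (p ⋆ s)
·≈⋆ p s k = sum-applyUpTo (λ i → p i * s (k ∸ i)) (λ i → i) (suc k)

≈⇒≪ : ∀ {p s} → p ≈ s → p ≪ s
≈⇒≪ eq k = ≤-reflexive (eq k)

shift-cong : ∀ {p s} → p ≈ s → shift p ≈ shift s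
shift-cong eq zero    = refl
shift-cong eq (suc k) = eq k

shift-mono : ∀ {p s} → p ≪ s → shift p ≪ shift s
shift-mono le zero    = z≤n
shift-mono le (suc k) = le k

shift-⊕ : ∀ p s → shift (p ⊕ s) ≈ (shift p ⊕ shift s)
shift-⊕ p s zero    = refl
shift-⊕ p s (suc k) = refl

⊕-mono : ∀ {p p′ s s′} → p ≪ p′ → s ≪ s′ → (p ⊕ s) ≪ (p′ ⊕ s′)
⊕-mono le le′ k = +-mono-≤ (le k) (le′ k)

⋆-congˡ : ∀ {p p′} s → p ≈ p′ → (p ⋆ s) ≈ (p′ ⋆ s)
⋆-congˡ s eq k = Σ<-cong (suc k) (λ i _ → cong (_* s (k ∸ i)) (eq i))

⋆-congʳ : ∀ p {s s′} → s ≈ s′ → (p ⋆ s) ≈ (p ⋆ s′)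
⋆-congʳ p eq k = Σ<-cong (suc k) (λ i _ → cong (p i *_) (eq (k ∸ i)))

⋆-monoʳ : ∀ p {s s′} → s ≪ s′ → (p ⋆ s) ≪ (p ⋆ s′)
⋆-monoʳ p le k = Σ<-mono (suc k) (λ i → *-monoʳ-≤ (p i) (le (k ∸ i)))

⋆-distribˡ : ∀ p p′ s → ((p ⊕ p′) ⋆ s) ≈ ((p ⋆ s) ⊕ (p′ ⋆ s))
⋆-distribˡ p p′ s k =
  trans (Σ<-cong (suc k) (λ i _ → *-distribʳ-+ (s (k ∸ i)) (p i) (p′ i)))
        (Σ<-+ (suc k) (λ i → p i * s (k ∸ i)) (λ i → p′ i * s (k ∸ i)))

⋆-distribʳ : ∀ p s s′ → (p ⋆ (s ⊕ s′)) ≈ ((p ⋆ s) ⊕ (p ⋆ s′))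
⋆-distribʳ p s s′ k =
  trans (Σ<-cong (suc k) (λ i _ → *-distribˡ-+ (p i) (s (k ∸ i)) (s′ (k ∸ i))))
        (Σ<-+ (suc k) (λ i → p i * s (k ∸ i)) (λ i → p i * s′ (k ∸ i)))

⋆-shiftˡ : ∀ p s → (shift p ⋆ s) ≈ shift (p ⋆ s)
⋆-shiftˡ p s zero    = refl
⋆-shiftˡ p s (suc k) = refl

-- q·s times p is q·(p s): the last summand of the convolution vanishes and
-- the remaining ones are shifted by one.
⋆-shiftʳ : ∀ p s → (p ⋆ shift s) ≈ shift (p ⋆ s)
⋆-shiftʳ p s zero    = cong (_+ 0) (*-zeroʳ (p 0))
⋆-shiftʳ p s (suc k) = begin
    Σ< (suc (suc k)) (λ i → p i * shift s (suc k ∸ i))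
  ≡⟨ Σ<-snoc (suc k) (λ i → p i * shift s (suc k ∸ i)) ⟩
    Σ< (suc k) (λ i → p i * shift s (suc k ∸ i)) + p (suc k) * shift s (suc k ∸ suc k)
  ≡⟨ cong₂ _+_ (Σ<-cong (suc k) {λ i → p i * shift s (suc k ∸ i)} λ i i≤k → cong (λ j → p i * shift s j) (+-∸-assoc 1 (≤-pred i≤k)))
               (trans (cong (λ j → p (suc k) * shift s j) (n∸n≡0 k)) (*-zeroʳ (p (suc k)))) ⟩
    Σ< (suc k) (λ i → p i * s (k ∸ i)) + 0
  ≡⟨ +-identityʳ _ ⟩
    Σ< (suc k) (λ i → p i * s (k ∸ i))
  ∎
  where open ≡-Reasoning

⋆-zeroˡ : ∀ s → (𝟘 ⋆ s) ≈ 𝟘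
⋆-zeroˡ s k = Σ<-zero (suc k) _ (λ _ → refl)

⋆-zeroʳ : ∀ p → (p ⋆ 𝟘) ≈ 𝟘
⋆-zeroʳ p k = Σ<-zero (suc k) _ (λ i → *-zeroʳ (p i))

⋆-identityˡ : ∀ s → (𝟙 ⋆ s) ≈ s
⋆-identityˡ s k =
  trans (cong (s k + 0 +_) (Σ<-zero k _ (λ _ → refl))) (trans (+-identityʳ _) (+-identityʳ _))

-- The expansion  (q b + a)(q e + c) = q (q·be + (bc + ae)) + ac,
-- which both sides of the inductive step are brought into.
⋆-expand : ∀ a b c e →
  ((shift b ⊕ a) ⋆ (shift e ⊕ c)) ≈ (shift (shift (b ⋆ e) ⊕ ((b ⋆ c) ⊕ (a ⋆ e))) ⊕ (a ⋆ c))
⋆-expand a b c e k = begin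
    ((shift b ⊕ a) ⋆ (shift e ⊕ c)) k
  ≡⟨ ⋆-distribˡ (shift b) a (shift e ⊕ c) k ⟩
    (shift b ⋆ (shift e ⊕ c)) k + (a ⋆ (shift e ⊕ c)) k
  ≡⟨ cong₂ _+_ (⋆-shiftˡ b _ k) (⋆-distribʳ a (shift e) c k) ⟩
    shift (b ⋆ (shift e ⊕ c)) k + ((a ⋆ shift e) k + (a ⋆ c) k)
  ≡⟨ cong (λ x → shift (b ⋆ (shift e ⊕ c)) k + (x + (a ⋆ c) k)) (⋆-shiftʳ a e k) ⟩
    shift (b ⋆ (shift e ⊕ c)) k + (shift (a ⋆ e) k + (a ⋆ c) k)
  ≡⟨ sym (+-assoc (shift (b ⋆ (shift e ⊕ c)) k) _ _) ⟩
    (shift (b ⋆ (shift e ⊕ c)) k + shift (a ⋆ e) k) + (a ⋆ c) k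
  ≡⟨ cong (_+ (a ⋆ c) k) (sym (shift-⊕ (b ⋆ (shift e ⊕ c)) (a ⋆ e) k)) ⟩
    shift ((b ⋆ (shift e ⊕ c)) ⊕ (a ⋆ e)) k + (a ⋆ c) k
  ≡⟨ cong (_+ (a ⋆ c) k) (shift-cong inner k) ⟩
    shift (shift (b ⋆ e) ⊕ ((b ⋆ c) ⊕ (a ⋆ e))) k + (a ⋆ c) k
  ∎
  where
  open ≡-Reasoning
  inner : ((b ⋆ (shift e ⊕ c)) ⊕ (a ⋆ e)) ≈ (shift (b ⋆ e) ⊕ ((b ⋆ c) ⊕ (a ⋆ e)))
  inner j = trans (cong (_+ (a ⋆ e) j)
                        (trans (⋆-distribʳ b (shift e) c j) (cong (_+ (b ⋆ c) j) (⋆-shiftʳ b e j))))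
                  (+-assoc (shift (b ⋆ e) j) _ _)

onePlusQPow-suc : ∀ n → onePlusQPow (suc n) ≈ (shift (onePlusQPow n) ⊕ onePlusQPow n)
onePlusQPow-suc n zero    = refl
onePlusQPow-suc n (suc i) = sym (nCk+nC[k+1]≡[n+1]C[k+1] n i)

onePlusQPow-zero : onePlusQPow 0 ≈ 𝟙
onePlusQPow-zero zero    = refl
onePlusQPow-zero (suc i) = refl

ind : Bool → ℕ
ind b = if b then 1 else 0

ind-∧ : ∀ a b → ind (a ∧ b) ≡ ind a * ind b
ind-∧ false b = refl
ind-∧ true  b = sym (+-identityʳ (ind b))

count-++ : ∀ {A : Set} (P : A → Bool) xs ys → countᵇ P (xs ++ ys) ≡ countᵇ P xs + countᵇ P ys
count-++ P []       ys = refl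
count-++ P (x ∷ xs) ys = trans (cong (ind (P x) +_) (count-++ P xs ys)) (sym (+-assoc (ind (P x)) _ _))

count-map : ∀ {A B : Set} (P : B → Bool) (f : A → B) xs →
  countᵇ P (map f xs) ≡ countᵇ (λ x → P (f x)) xs
count-map P f []       = refl
count-map P f (x ∷ xs) = cong (ind (P (f x)) +_) (count-map P f xs)

count-cong : ∀ {A : Set} {P Q : A → Bool} xs → (∀ x → P x ≡ Q x) → countᵇ P xs ≡ countᵇ Q xs
count-cong []       eq = refl
count-cong (x ∷ xs) eq = cong₂ _+_ (cong ind (eq x)) (count-cong xs eq)

count-false : ∀ {A : Set} (xs : List A) → countᵇ (λ _ → false) xs ≡ 0
count-false []       = refl
count-false (x ∷ xs) = count-false xs

count-pair-mono : ∀ {A : Set} (P Q R T : A → Bool) xs →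
  (∀ x → ind (P x) + ind (Q x) ≤ ind (R x) + ind (T x)) →
  countᵇ P xs + countᵇ Q xs ≤ countᵇ R xs + countᵇ T xs
count-pair-mono P Q R T []       le = z≤n
count-pair-mono P Q R T (x ∷ xs) le = begin
    (ind (P x) + countᵇ P xs) + (ind (Q x) + countᵇ Q xs)
  ≡⟨ interchange (ind (P x)) _ _ _ ⟩
    (ind (P x) + ind (Q x)) + (countᵇ P xs + countᵇ Q xs)
  ≤⟨ +-mono-≤ (le x) (count-pair-mono P Q R T xs le) ⟩
    (ind (R x) + ind (T x)) + (countᵇ R xs + countᵇ T xs)
  ≡⟨ interchange (ind (R x)) _ _ _ ⟩
    (ind (R x) + countᵇ R xs) + (ind (T x) + countᵇ T xs)
  ∎
  where
  open ≤-Reasoning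
  interchange : ∀ a b c d → (a + b) + (c + d) ≡ (a + c) + (b + d)
  interchange = solve-∀

Fam : ℕ → Set
Fam n = Subset n → Bool

-- f-polynomial of a family; fPoly Δ is definitionally fP (face Δ).
fP : ∀ {n} → Fam n → Poly
fP {n} F i = countᵇ (λ σ → F σ ∧ (∣ σ ∣ ≡ᵇ i)) (allSubsets n)

_∩ᶠ_ : ∀ {n} → Fam n → Fam n → Fam n
(F ∩ᶠ G) σ = F σ ∧ G σ

DownClosed : ∀ {n} → Fam n → Set
DownClosed {n} F = ∀ (σ τ : Subset n) → σ ⊆ τ → F τ ≡ true → F σ ≡ true

del lk : ∀ {n} → Fam (suc n) → Fam n
del F σ = F (false ∷ σ)
lk  F σ = F (true ∷ σ)

del-downClosed : ∀ {n} {F : Fam (suc n)} → DownClosed F → DownClosed (del F)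
del-downClosed dc σ τ σ⊆τ = dc _ _ (s⊆s σ⊆τ)

lk-downClosed : ∀ {n} {F : Fam (suc n)} → DownClosed F → DownClosed (lk F)
lk-downClosed dc σ τ σ⊆τ = dc _ _ (s⊆s σ⊆τ)

lk⊆del : ∀ {n} {F : Fam (suc n)} → DownClosed F → ∀ σ → lk F σ ≡ true → del F σ ≡ true
lk⊆del dc σ = dc _ _ (out⊆ (λ x∈σ → x∈σ))

-- f_F = q·f_{lk F} + f_{del F}: faces through the first vertex lose it in the link.
fP-split : ∀ {n} (F : Fam (suc n)) → fP F ≈ (shift (fP (lk F)) ⊕ fP (del F))
fP-split {n} F i = begin
    countᵇ P (map (true ∷_) (allSubsets n) ++ map (false ∷_) (allSubsets n))
  ≡⟨ count-++ P (map (true ∷_) (allSubsets n)) _ ⟩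
    countᵇ P (map (true ∷_) (allSubsets n)) + countᵇ P (map (false ∷_) (allSubsets n))
  ≡⟨ cong₂ _+_ (trans (count-map P (true ∷_) (allSubsets n)) (through i))
               (count-map P (false ∷_) (allSubsets n)) ⟩
    shift (fP (lk F)) i + fP (del F) i
  ∎
  where
  open ≡-Reasoning
  P : Subset (suc n) → Bool
  P σ = F σ ∧ (∣ σ ∣ ≡ᵇ i)
  through : ∀ i → countᵇ (λ σ → lk F σ ∧ (suc ∣ σ ∣ ≡ᵇ i)) (allSubsets n) ≡ shift (fP (lk F)) i
  through zero    = trans (count-cong (allSubsets n) (λ σ → ∧-zeroʳ (lk F σ))) (count-false (allSubsets n))
  through (suc j) = refl

crossing : ∀ d₁ l₁ d₂ l₂ → (l₁ ≡ true → d₁ ≡ true) → (l₂ ≡ true → d₂ ≡ true) →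
  ind (l₁ ∧ d₂) + ind (d₁ ∧ l₂) ≤ ind (d₁ ∧ d₂) + ind (l₁ ∧ l₂)
crossing d₁    true  d₂    l₂    h₁ h₂ rewrite h₁ refl = ≤-refl
crossing d₁    false d₂    true  h₁ h₂ rewrite h₂ refl = ≤-reflexive (sym (+-identityʳ _))
crossing false false d₂    false h₁ h₂ = z≤n
crossing true  false d₂    false h₁ h₂ = z≤n

crossing-sized : ∀ d₁ l₁ d₂ l₂ s → (l₁ ≡ true → d₁ ≡ true) → (l₂ ≡ true → d₂ ≡ true) →
  ind ((l₁ ∧ d₂) ∧ s) + ind ((d₁ ∧ l₂) ∧ s) ≤ ind ((d₁ ∧ d₂) ∧ s) + ind ((l₁ ∧ l₂) ∧ s)
crossing-sized d₁ l₁ d₂ l₂ s h₁ h₂ = begin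
    ind ((l₁ ∧ d₂) ∧ s) + ind ((d₁ ∧ l₂) ∧ s)
  ≡⟨ cong₂ _+_ (ind-∧ (l₁ ∧ d₂) s) (ind-∧ (d₁ ∧ l₂) s) ⟩
    ind (l₁ ∧ d₂) * ind s + ind (d₁ ∧ l₂) * ind s
  ≡⟨ sym (*-distribʳ-+ (ind s) (ind (l₁ ∧ d₂)) (ind (d₁ ∧ l₂))) ⟩
    (ind (l₁ ∧ d₂) + ind (d₁ ∧ l₂)) * ind s
  ≤⟨ *-monoˡ-≤ (ind s) (crossing d₁ l₁ d₂ l₂ h₁ h₂) ⟩
    (ind (d₁ ∧ d₂) + ind (l₁ ∧ l₂)) * ind s
  ≡⟨ *-distribʳ-+ (ind s) (ind (d₁ ∧ d₂)) (ind (l₁ ∧ l₂)) ⟩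
    ind (d₁ ∧ d₂) * ind s + ind (l₁ ∧ l₂) * ind s
  ≡⟨ sym (cong₂ _+_ (ind-∧ (d₁ ∧ d₂) s) (ind-∧ (l₁ ∧ l₂) s)) ⟩
    ind ((d₁ ∧ d₂) ∧ s) + ind ((l₁ ∧ l₂) ∧ s)
  ∎
  where open ≤-Reasoning

fP-crossing : ∀ {n} (F G : Fam (suc n)) → DownClosed F → DownClosed G →
  (fP (lk F ∩ᶠ del G) ⊕ fP (del F ∩ᶠ lk G)) ≪ (fP (del F ∩ᶠ del G) ⊕ fP (lk F ∩ᶠ lk G))
fP-crossing {n} F G dcF dcG i =
  count-pair-mono (sized (lk F ∩ᶠ del G)) (sized (del F ∩ᶠ lk G))
                  (sized (del F ∩ᶠ del G)) (sized (lk F ∩ᶠ lk G)) (allSubsets n)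
    (λ σ → crossing-sized (del F σ) (lk F σ) (del G σ) (lk G σ) (∣ σ ∣ ≡ᵇ i)
                          (lk⊆del dcF σ) (lk⊆del dcG σ))
  where
  sized : Fam n → Fam n
  sized H σ = H σ ∧ (∣ σ ∣ ≡ᵇ i)

fP-empty : (F : Fam 0) → F [] ≡ false → fP F ≈ 𝟘
fP-empty F no k rewrite no = refl

fP-unit : (F : Fam 0) → F [] ≡ true → fP F ≈ 𝟙
fP-unit F yes zero    rewrite yes = refl
fP-unit F yes (suc k) rewrite yes = refl

-- Base case: both sides agree when both families are {∅}, else the left side is 0.
product-bound-base : (F G : Fam 0) → (fP F ⋆ fP G) ≪ (onePlusQPow 0 ⋆ fP (F ∩ᶠ G))
product-bound-base F G = by-cases (F []) (G []) refl refl
  where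
  by-cases : ∀ b₁ b₂ → F [] ≡ b₁ → G [] ≡ b₂ → (fP F ⋆ fP G) ≪ (onePlusQPow 0 ⋆ fP (F ∩ᶠ G))
  by-cases false _ eF eG k =
    ≤-trans (≤-reflexive (trans (⋆-congˡ (fP G) (fP-empty F eF) k) (⋆-zeroˡ (fP G) k))) z≤n
  by-cases true false eF eG k =
    ≤-trans (≤-reflexive (trans (⋆-congʳ (fP F) (fP-empty G eG) k) (⋆-zeroʳ (fP F) k))) z≤n
  by-cases true true eF eG = ≈⇒≪ λ k → begin
      (fP F ⋆ fP G) k                 ≡⟨ ⋆-congʳ (fP F) (fP-unit G eG) k ⟩
      (fP F ⋆ 𝟙) k                    ≡⟨ ⋆-congˡ 𝟙 (fP-unit F eF) k ⟩
      (𝟙 ⋆ 𝟙) k                       ≡⟨ ⋆-identityˡ 𝟙 k ⟩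
      𝟙 k                             ≡⟨ sym (fP-unit (F ∩ᶠ G) (cong₂ _∧_ eF eG) k) ⟩
      fP (F ∩ᶠ G) k                   ≡⟨ sym (⋆-identityˡ (fP (F ∩ᶠ G)) k) ⟩
      (𝟙 ⋆ fP (F ∩ᶠ G)) k             ≡⟨ sym (⋆-congˡ (fP (F ∩ᶠ G)) onePlusQPow-zero k) ⟩
      (onePlusQPow 0 ⋆ fP (F ∩ᶠ G)) k ∎
    where open ≡-Reasoning

product-bound : ∀ n (F G : Fam n) → DownClosed F → DownClosed G →
  (fP F ⋆ fP G) ≪ (onePlusQPow n ⋆ fP (F ∩ᶠ G))
product-bound zero    F G dcF dcG = product-bound-base F G
product-bound (suc n) F G dcF dcG k = begin
    (fP F ⋆ fP G) k
  ≡⟨ trans (⋆-congʳ (fP F) (fP-split G) k) (⋆-congˡ (shift (fP lG) ⊕ fP dG) (fP-split F) k) ⟩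
    ((shift (fP lF) ⊕ fP dF) ⋆ (shift (fP lG) ⊕ fP dG)) k
  ≡⟨ ⋆-expand (fP dF) (fP lF) (fP dG) (fP lG) k ⟩
    (shift (shift (fP lF ⋆ fP lG) ⊕ ((fP lF ⋆ fP dG) ⊕ (fP dF ⋆ fP lG))) ⊕ (fP dF ⋆ fP dG)) k
  ≤⟨ ⊕-mono (shift-mono (⊕-mono (shift-mono (IH lF lG dclF dclG)) cross)) (IH dF dG dcdF dcdG) k ⟩
    (shift (shift (P ⋆ L) ⊕ ((P ⋆ D) ⊕ (P ⋆ L))) ⊕ (P ⋆ D)) k
  ≡⟨ sym (⋆-expand P P D L k) ⟩
    ((shift P ⊕ P) ⋆ (shift L ⊕ D)) k
  ≡⟨ sym (trans (⋆-congʳ (onePlusQPow (suc n)) (fP-split (F ∩ᶠ G)) k)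
               (⋆-congˡ (shift L ⊕ D) (onePlusQPow-suc n) k)) ⟩
    (onePlusQPow (suc n) ⋆ fP (F ∩ᶠ G)) k
  ∎
  where
  open ≤-Reasoning
  IH : ∀ (F′ G′ : Fam n) → DownClosed F′ → DownClosed G′ →
       (fP F′ ⋆ fP G′) ≪ (onePlusQPow n ⋆ fP (F′ ∩ᶠ G′))
  IH = product-bound n
  dF lF dG lG : Fam n
  dF = del F ; lF = lk F ; dG = del G ; lG = lk G
  dcdF : DownClosed dF
  dcdF = del-downClosed dcF
  dclF : DownClosed lF
  dclF = lk-downClosed dcF
  dcdG : DownClosed dG
  dcdG = del-downClosed dcG
  dclG : DownClosed lG
  dclG = lk-downClosed dcG
  P D L : Poly
  P = onePlusQPow n
  D = fP (dF ∩ᶠ dG)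
  L = fP (lF ∩ᶠ lG)
  cross : ((fP lF ⋆ fP dG) ⊕ (fP dF ⋆ fP lG)) ≪ ((P ⋆ D) ⊕ (P ⋆ L))
  cross j = begin
      (fP lF ⋆ fP dG) j + (fP dF ⋆ fP lG) j
    ≤⟨ +-mono-≤ (IH lF dG dclF dcdG j) (IH dF lG dcdF dclG j) ⟩
      (P ⋆ fP (lF ∩ᶠ dG)) j + (P ⋆ fP (dF ∩ᶠ lG)) j
    ≡⟨ sym (⋆-distribʳ P (fP (lF ∩ᶠ dG)) (fP (dF ∩ᶠ lG)) j) ⟩
      (P ⋆ (fP (lF ∩ᶠ dG) ⊕ fP (dF ∩ᶠ lG))) j
    ≤⟨ ⋆-monoʳ P (fP-crossing F G dcF dcG) j ⟩
      (P ⋆ (D ⊕ L)) j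
    ≡⟨ ⋆-distribʳ P D L j ⟩
      (P ⋆ D) j + (P ⋆ L) j
    ∎

theorem3p1 : (n : ℕ) (Δ Γ : SimplicialComplex n) →
    ∀ (k : ℕ) → (fPoly Δ · fPoly Γ) k ≤ (onePlusQPow n · fPoly (Δ ∩ᶜ Γ)) k
theorem3p1 n Δ Γ k = begin
    (fPoly Δ · fPoly Γ) k                     ≡⟨ ·≈⋆ (fPoly Δ) (fPoly Γ) k ⟩
    (fP (face Δ) ⋆ fP (face Γ)) k             ≤⟨ product-bound n (face Δ) (face Γ) (down-closed Δ) (down-closed Γ) k ⟩
    (onePlusQPow n ⋆ fPoly (Δ ∩ᶜ Γ)) k        ≡⟨ sym (·≈⋆ (onePlusQPow n) (fPoly (Δ ∩ᶜ Γ)) k) ⟩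
    (onePlusQPow n · fPoly (Δ ∩ᶜ Γ)) k        ∎
  where open ≤-Reasoning
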